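{- Let $q$ be an odd square-free positive integer and let $A\subseteq\mathbb{Z}_q^{\ast}$ satisfy $|A|>\frac12\varphi(q)$, where $\varphi$ is Euler's totient function. Then $A+A+A+A=\mathbb{Z}_q$.
   Context: $\mathbb{Z}_q=\mathbb{Z}/q\mathbb{Z}$ and $\mathbb{Z}_q^{\ast}$ is its group of units. $A+A+A+A=\{a_1+a_2+a_3+a_4: a_i\in A\}$. -}

module Defs where

open import Data.Nat using (ℕ; _+_; _*_; _%_; NonZero)
open import Data.Nat.Divisibility using (_∣_)
open import Data.Nat.Primality using (Prime)
open import Data.Nat.Coprimality using (Coprime; coprime?)
open import Data.List using (List; length; filter; upTo)
open import Data.Fin using (Fin; toℕ)
open import Data.Fin.Subset using (Subset; _∈_)
open import Data.Empty using (⊥)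
open import Data.Product using (∃-syntax; _×_)
open import Relation.Binary.PropositionalEquality using (_≡_)

SquareFree : ℕ → Set
SquareFree q = ∀ p → Prime p → p * p ∣ q → ⊥

φ : ℕ → ℕ
φ q = length (filter (λ x → coprime? x q) (upTo q))

-- Z_q is modelled as Fin q; x is a unit iff toℕ x is coprime to q
IsUnit : (q : ℕ) → Fin q → Set
IsUnit q x = Coprime (toℕ x) q

UnitSubset : (q : ℕ) → Subset q → Set
UnitSubset q A = ∀ x → x ∈ A → IsUnit q x

InFourfoldSum : (q : ℕ) .{{_ : NonZero q}} → Subset q → Fin q → Set
InFourfoldSum q A z =
  ∃[ a₁ ] ∃[ a₂ ] ∃[ a₃ ] ∃[ a₄ ]
    (a₁ ∈ A × a₂ ∈ A × a₃ ∈ A × a₄ ∈ A ×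
     (toℕ a₁ + toℕ a₂ + toℕ a₃ + toℕ a₄) % q ≡ toℕ z)

-- Refine residues modulo q one prime at a time. If p ∤ n, a class c of units modulo n splits into
-- the classes c + j n modulo p n (j < p): exactly one of them (p ∣ c + j n) contains no units, and
-- while primes ps remain, each unit class holds ∏ (p − 1) units over ps. By induction on ps: if
-- A₁, …, A₄ lie in unit classes c₁, …, c₄ modulo n and both |A₁| + |A₂| and |A₃| + |A₄| exceed that
-- number, then A₁ + A₂ + A₃ + A₄ contains every residue ≡ c₁ + c₂ + c₃ + c₄ (mod n).
-- For the step, a layer-cake argument on the sizes of the p fibres of A₁ and A₂ gives X, Y ⊆ ℤ_p with
-- |X| + |Y| ≥ p, both missing the unit-free fibre, such that any digits x ∈ X, y ∈ Y leave fibres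
-- large enough for the induction. Such an X + Y misses at most one residue, for otherwise X would be
-- invariant under a nonzero translation of ℤ_p. Hence (A₁, A₂) can realise all but one digit sum w,
-- and (A₃, A₄) all but one of k − w; as p ≥ 3, some w ∈ {0, 1, 2} serves both.
-- The theorem is the case n = 1 and A₁ = ⋯ = A₄ = A, since φ(q) ≥ ∏ (p − 1).

module Submission where

open import Defs
open import Data.Nat using (ℕ; _*_; _<_; _%_; NonZero)
open import Data.Nat.Divisibility using (_∣_)
open import Data.Fin using (Fin)
open import Data.Fin.Subset using (Subset; ∣_∣)
open import Data.Empty using (⊥)

open import Data.Bool using (Bool; true; false; not; _∧_; _∨_; T)
open import Data.Bool.Properties using (∧-assoc; ∧-identityʳ)
open import Data.Empty using (⊥-elim)
open import Data.Fin as Fin using (toℕ; fromℕ<)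
open import Data.Fin.Permutation using (Permutation; permutation)
open import Data.Fin.Properties using (toℕ<n; toℕ-fromℕ<; toℕ-injective)
open import Data.Fin.Subset using (_∈_)
open import Data.List using (List; []; _∷_; length; filter; applyUpTo)
open import Data.List.Relation.Unary.All using (All; []; _∷_)
open import Data.Nat
open import Data.Nat.Coprimality
  using (Coprime; coprime?; 1-coprimeTo; coprime-Bézout; prime⇒coprime; coprime-divisor)
  renaming (sym to coprime-sym)
open import Data.Nat.Divisibility using (divides; ∣-trans; ∣m+n∣m⇒∣n; ∣n⇒∣m*n; m∣m*n; ∣n∣m%n⇒∣m; >⇒∤; m%n≡0⇒n∣m)
open import Data.Nat.DivMod
open import Data.Nat.GCD using (module Bézout)
open import Data.Nat.ListAction using (product)
open import Data.Nat.Primality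
  using (Prime; ¬prime[0]; ¬prime[1]; euclidsLemma; prime⇒irreducible; prime⇒nonZero; productOfPrimes≢0)
open import Data.Nat.Primality.Factorisation using (factorise; PrimeFactorisation)
open import Data.Nat.Properties
open import Data.Nat.Tactic.RingSolver using (solve-∀)
open import Data.Product using (∃; _×_; _,_; proj₁; proj₂)
open import Data.Sum using (_⊎_; inj₁; inj₂; [_,_]′)
import Data.Sum as Sum
open import Data.Vec.Base using (_∷_; []; here; there)
open import Function using (_∘_; id)
open import Level using (0ℓ)
open import Relation.Binary.PropositionalEquality
  using (_≡_; _≢_; refl; sym; trans; cong; cong₂; subst; subst₂; module ≡-Reasoning)
open import Relation.Nullary using (¬_; Dec; yes; no; does)
open import Relation.Nullary.Decidable using (dec-true)
open import Relation.Unary using (Pred; Decidable)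
open import Algebra.Properties.CommutativeMonoid.Sum +-0-commutativeMonoid
  using (sum; sum-cong-≗; ∑-comm; ∑-distrib-+; sum-permute)

∧-≡-true : ∀ {a b} → a ∧ b ≡ true → a ≡ true × b ≡ true
∧-≡-true {true} b≡true = refl , b≡true

∧-≡-false : ∀ {a b} → a ∧ b ≡ false → a ≡ true → b ≡ false
∧-≡-false a∧b≡false refl = a∧b≡false

∨-≡-true : ∀ {a b} → a ∨ b ≡ true → b ≡ false → a ≡ true
∨-≡-true {true} _ _ = refl
∨-≡-true {false} b≡true b≡false = trans (sym b≡false) b≡true

≤ᵇ-suc : ∀ m n → (suc m ≤ᵇ suc n) ≡ (m ≤ᵇ n)
≤ᵇ-suc zero n = refl
≤ᵇ-suc (suc m) n = refl

≤⇒≤ᵇ≡true : ∀ {m n} → m ≤ n → (m ≤ᵇ n) ≡ true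
≤⇒≤ᵇ≡true {m} {n} m≤n with m ≤ᵇ n | ≤⇒≤ᵇ m≤n
... | true | _ = refl

≤ᵇ≡true⇒≤ : ∀ {m n} → (m ≤ᵇ n) ≡ true → m ≤ n
≤ᵇ≡true⇒≤ {m} {n} eq = ≤ᵇ⇒≤ m n (subst T (sym eq) _)

<ᵇ≡true⇒< : ∀ {m n} → (m <ᵇ n) ≡ true → m < n
<ᵇ≡true⇒< {m} {n} eq = <ᵇ⇒< m n (subst T (sym eq) _)

>⇒≤ᵇ≡false : ∀ {m n} → n < m → (m ≤ᵇ n) ≡ false
>⇒≤ᵇ≡false {m} {n} n<m with m ≤ᵇ n | ≤ᵇ⇒≤ m n
... | false | _ = refl
... | true | m≤n = ⊥-elim (<⇒≱ n<m (m≤n _))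

≡ᵇ≡true⇒≡ : ∀ {m n} → (m ≡ᵇ n) ≡ true → m ≡ n
≡ᵇ≡true⇒≡ {m} {n} eq = ≡ᵇ⇒≡ m n (subst T (sym eq) _)

≡⇒≡ᵇ≡true : ∀ {m n} → m ≡ n → (m ≡ᵇ n) ≡ true
≡⇒≡ᵇ≡true {m} {n} m≡n with m ≡ᵇ n | ≡⇒≡ᵇ m n m≡n
... | true | _ = refl

≢⇒≡ᵇ≡false : ∀ {m n} → m ≢ n → (m ≡ᵇ n) ≡ false
≢⇒≡ᵇ≡false {m} {n} m≢n with m ≡ᵇ n in eq
... | false = refl
... | true = ⊥-elim (m≢n (≡ᵇ≡true⇒≡ eq))

∑< : ℕ → (ℕ → ℕ) → ℕ
∑< n f = sum {n} (f ∘ toℕ)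

∑<-cong : ∀ n {f g} → (∀ i → i < n → f i ≡ g i) → ∑< n f ≡ ∑< n g
∑<-cong zero f≗g = refl
∑<-cong (suc n) f≗g = cong₂ _+_ (f≗g 0 z<s) (∑<-cong n (λ i i<n → f≗g (suc i) (s<s i<n)))

∑<-mono-≤ : ∀ n {f g} → (∀ i → i < n → f i ≤ g i) → ∑< n f ≤ ∑< n g
∑<-mono-≤ zero f≤g = z≤n
∑<-mono-≤ (suc n) f≤g = +-mono-≤ (f≤g 0 z<s) (∑<-mono-≤ n (λ i i<n → f≤g (suc i) (s<s i<n)))

∑<-distrib-+ : ∀ n f g → ∑< n (λ i → f i + g i) ≡ ∑< n f + ∑< n g
∑<-distrib-+ n f g = ∑-distrib-+ {n} (f ∘ toℕ) (g ∘ toℕ)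

∑<-comm : ∀ m n (f : ℕ → ℕ → ℕ) → ∑< m (λ i → ∑< n (f i)) ≡ ∑< n (λ j → ∑< m (λ i → f i j))
∑<-comm m n f = ∑-comm {m} {n} (λ i j → f (toℕ i) (toℕ j))

∑<-const : ∀ n c → ∑< n (λ _ → c) ≡ n * c
∑<-const zero c = refl
∑<-const (suc n) c = cong (c +_) (∑<-const n c)

∑<-zero : ∀ n → ∑< n (λ _ → 0) ≡ 0
∑<-zero n = trans (∑<-const n 0) (*-zeroʳ n)

∑<-≥-term : ∀ n f {i} → i < n → f i ≤ ∑< n f
∑<-≥-term (suc n) f {zero} _ = m≤m+n (f 0) _
∑<-≥-term (suc n) f {suc i} (s<s i<n) = ≤-trans (∑<-≥-term n (f ∘ suc) i<n) (m≤n+m _ (f 0))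

∑<-≤-except : ∀ n f {B e} → (∀ i → i < n → f i ≤ B) → e < n → f e ≡ 0 → ∑< n f ≤ pred n * B
∑<-≤-except (suc n) f {B} {zero} f≤B _ f0≡0 = begin
  f 0 + ∑< n (f ∘ suc) ≡⟨ cong (_+ ∑< n (f ∘ suc)) f0≡0 ⟩
  ∑< n (f ∘ suc)       ≤⟨ ∑<-mono-≤ n (λ i i<n → f≤B (suc i) (s<s i<n)) ⟩
  ∑< n (λ _ → B)       ≡⟨ ∑<-const n B ⟩
  n * B                ∎
  where open ≤-Reasoning
∑<-≤-except (suc n@(suc _)) f {B} {suc e} f≤B (s<s e<n) fe≡0 =
  +-mono-≤ (f≤B 0 z<s) (∑<-≤-except n (f ∘ suc) (λ i i<n → f≤B (suc i) (s<s i<n)) e<n fe≡0)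

∑<-≥-except : ∀ n f {B e} → (∀ i → i < n → i ≢ e → B ≤ f i) → e < n → pred n * B ≤ ∑< n f
∑<-≥-except (suc n) f {B} {zero} B≤f _ = begin
  n * B                ≡⟨ ∑<-const n B ⟨
  ∑< n (λ _ → B)       ≤⟨ ∑<-mono-≤ n (λ i i<n → B≤f (suc i) (s<s i<n) λ ()) ⟩
  ∑< n (f ∘ suc)       ≤⟨ m≤n+m _ (f 0) ⟩
  f 0 + ∑< n (f ∘ suc) ∎
  where open ≤-Reasoning
∑<-≥-except (suc n@(suc _)) f {B} {suc e} B≤f (s<s e<n) =
  +-mono-≤ (B≤f 0 z<s λ ()) (∑<-≥-except n (f ∘ suc) (λ i i<n i≢e → B≤f (suc i) (s<s i<n) (i≢e ∘ suc-injective)) e<n)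

∑<-pigeonhole : ∀ n f {B} → n * B < ∑< n f → ∃ λ i → i < n × B < f i
∑<-pigeonhole zero f {B} n*B<0 = ⊥-elim (n≮0 n*B<0)
∑<-pigeonhole (suc n) f {B} nB<∑ with B <? f 0
... | yes B<f0 = 0 , z<s , B<f0
... | no B≮f0 with ∑<-pigeonhole n (f ∘ suc) (+-cancelˡ-< B _ _ (<-≤-trans nB<∑ (+-monoˡ-≤ _ (≮⇒≥ B≮f0))))
... | i , i<n , B<fi = suc i , s<s i<n , B<fi

∑<-permute : ∀ n f {σ τ : ℕ → ℕ} → (∀ i → i < n → σ i < n) → (∀ i → i < n → τ i < n) →
             (∀ i → i < n → σ (τ i) ≡ i) → (∀ i → i < n → τ (σ i) ≡ i) → ∑< n (f ∘ σ) ≡ ∑< n f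
∑<-permute n f {σ} {τ} σ< τ< στ τσ = sym (trans (sum-permute (f ∘ toℕ) π) (sum-cong-≗ {n} (λ i → cong f (toℕ-fromℕ< _))))
  where
  onFin : (h : ℕ → ℕ) → (∀ i → i < n → h i < n) → Fin n → Fin n
  onFin h h< i = fromℕ< (h< (toℕ i) (toℕ<n i))
  inverse : ∀ {h k} h< k< → (∀ i → i < n → h (k i) ≡ i) → ∀ i → onFin h h< (onFin k k< i) ≡ i
  inverse {h} h< k< hk i = toℕ-injective (trans (toℕ-fromℕ< _) (trans (cong h (toℕ-fromℕ< _)) (hk (toℕ i) (toℕ<n i))))
  π : Permutation n n
  π = permutation (onFin σ σ<) (onFin τ τ<) (inverse σ< τ< στ) (inverse τ< σ< τσ)

𝟙 : Bool → ℕ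
𝟙 true = 1
𝟙 false = 0

count : ℕ → (ℕ → Bool) → ℕ
count n P = ∑< n (𝟙 ∘ P)

𝟙-not : ∀ b → 𝟙 b + 𝟙 (not b) ≡ 1
𝟙-not true = refl
𝟙-not false = refl

𝟙-∨ : ∀ a b → 𝟙 a + 𝟙 b ≡ 𝟙 (a ∨ b) + 𝟙 (a ∧ b)
𝟙-∨ true true = refl
𝟙-∨ true false = refl
𝟙-∨ false b = sym (+-identityʳ _)

witness-or-none : ∀ n (P : ℕ → Bool) → (∃ λ x → x < n × P x ≡ true) ⊎ (∀ x → x < n → P x ≡ false)
witness-or-none zero P = inj₂ λ _ ()
witness-or-none (suc n) P with P 0 in P0 | witness-or-none n (P ∘ suc)
... | true  | _ = inj₁ (0 , z<s , P0)
... | false | inj₁ (x , x<n , Px) = inj₁ (suc x , s<s x<n , Px)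
... | false | inj₂ none = inj₂ λ where
  zero _ → P0
  (suc x) (s<s x<n) → none x x<n

count-none : ∀ n P → (∀ x → x < n → P x ≡ false) → count n P ≡ 0
count-none n P none = trans (∑<-cong n (λ x x<n → cong 𝟙 (none x x<n))) (∑<-zero n)

count-witness : ∀ n P → 0 < count n P → ∃ λ x → x < n × P x ≡ true
count-witness n P 0<count with witness-or-none n P
... | inj₁ witness = witness
... | inj₂ none = ⊥-elim (<-irrefl (sym (count-none n P none)) 0<count)

count-mono : ∀ n {P Q} → (∀ x → x < n → P x ≡ true → Q x ≡ true) → count n P ≤ count n Q
count-mono n {P} {Q} P⇒Q = ∑<-mono-≤ n 𝟙-mono
  where
  𝟙-mono : ∀ x → x < n → 𝟙 (P x) ≤ 𝟙 (Q x)
  𝟙-mono x x<n with P x in Px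
  ... | false = z≤n
  ... | true rewrite P⇒Q x x<n Px = ≤-refl

count-complement : ∀ n P → count n P + count n (not ∘ P) ≡ n
count-complement n P = begin
  count n P + count n (not ∘ P)        ≡⟨ ∑<-distrib-+ n (𝟙 ∘ P) (𝟙 ∘ not ∘ P) ⟨
  ∑< n (λ x → 𝟙 (P x) + 𝟙 (not (P x))) ≡⟨ ∑<-cong n (λ x _ → 𝟙-not (P x)) ⟩
  ∑< n (λ _ → 1)                       ≡⟨ ∑<-const n 1 ⟩
  n * 1                                ≡⟨ *-identityʳ n ⟩
  n                                    ∎
  where open ≡-Reasoning

count-full : ∀ n P → n ≤ count n P → ∀ x → x < n → P x ≡ true
count-full n P n≤count x x<n with P x in Px
... | true = refl
... | false = ⊥-elim (<-irrefl refl (begin-strict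
  count n P                     <⟨ m<m+n _ not-P-occurs ⟩
  count n P + count n (not ∘ P) ≡⟨ count-complement n P ⟩
  n                             ≤⟨ n≤count ⟩
  count n P                     ∎))
  where
  open ≤-Reasoning
  not-P-occurs : 1 ≤ count n (not ∘ P)
  not-P-occurs = subst (_≤ count n (not ∘ P)) (cong (𝟙 ∘ not) Px) (∑<-≥-term n (𝟙 ∘ not ∘ P) x<n)

count-disjoint-cover : ∀ n P Q → n ≤ count n P + count n Q → (∀ x → x < n → P x ∧ Q x ≡ false) →
                       ∀ x → x < n → P x ∨ Q x ≡ true
count-disjoint-cover n P Q n≤ disjoint = count-full n (λ x → P x ∨ Q x) (≤-trans n≤ (≤-reflexive count-∨))
  where
  open ≡-Reasoning
  count-∨ : count n P + count n Q ≡ count n (λ x → P x ∨ Q x)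
  count-∨ = begin
    count n P + count n Q          ≡⟨ ∑<-distrib-+ n (𝟙 ∘ P) (𝟙 ∘ Q) ⟨
    ∑< n (λ x → 𝟙 (P x) + 𝟙 (Q x)) ≡⟨ ∑<-cong n (λ x x<n → trans (𝟙-∨ (P x) (Q x)) (cong (λ b → 𝟙 (P x ∨ Q x) + 𝟙 b) (disjoint x x<n))) ⟩
    ∑< n (λ x → 𝟙 (P x ∨ Q x) + 0) ≡⟨ ∑<-cong n (λ x _ → +-identityʳ (𝟙 (P x ∨ Q x))) ⟩
    count n (λ x → P x ∨ Q x)      ∎

count-≡ᵇ : ∀ n {c} → c < n → count n (_≡ᵇ c) ≡ 1
count-≡ᵇ (suc n) {zero} _ = cong suc (∑<-zero n)
count-≡ᵇ (suc n) {suc c} (s<s c<n) = count-≡ᵇ n c<n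

count-≡ᵇ-≤1 : ∀ n c → count n (_≡ᵇ c) ≤ 1
count-≡ᵇ-≤1 zero c = z≤n
count-≡ᵇ-≤1 (suc n) zero = ≤-reflexive (cong suc (∑<-zero n))
count-≡ᵇ-≤1 (suc n) (suc c) = count-≡ᵇ-≤1 n c

𝟙-spread : ∀ b {p d} → d < p → 𝟙 b ≡ count p (λ j → b ∧ (j ≡ᵇ d))
𝟙-spread true {p} d<p = sym (count-≡ᵇ p d<p)
𝟙-spread false {p} _ = sym (∑<-zero p)

count-<ᵇ : ∀ F {a} → a ≤ F → count F (_<ᵇ a) ≡ a
count-<ᵇ F {zero} _ = ∑<-zero F
count-<ᵇ (suc F) {suc a} (s≤s a≤F) = cong suc (count-<ᵇ F a≤F)

count-≤ᵇ-+ : ∀ F {a} → a ≤ F → count F (λ t → F ≤ᵇ t + a) ≡ a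
count-≤ᵇ-+ zero z≤n = refl
count-≤ᵇ-+ (suc F) {a} a≤1+F with m≤n⇒m<n∨m≡n a≤1+F
... | inj₁ (s≤s a≤F) = begin
  𝟙 (suc F ≤ᵇ a) + count F (λ t → suc F ≤ᵇ suc (t + a))
    ≡⟨ cong₂ _+_ (cong 𝟙 (>⇒≤ᵇ≡false (s≤s a≤F))) (∑<-cong F (λ t _ → cong 𝟙 (≤ᵇ-suc F (t + a)))) ⟩
  0 + count F (λ t → F ≤ᵇ t + a)
    ≡⟨ count-≤ᵇ-+ F a≤F ⟩
  a ∎
  where open ≡-Reasoning
... | inj₂ refl = begin
  𝟙 (suc F ≤ᵇ suc F) + count F (λ t → suc F ≤ᵇ suc (t + suc F))
    ≡⟨ cong₂ _+_ (cong 𝟙 (≤⇒≤ᵇ≡true (≤-refl {suc F}))) (∑<-cong F (λ t _ → cong 𝟙 (≤⇒≤ᵇ≡true (F+1≤t+F+1 t)))) ⟩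
  1 + ∑< F (λ _ → 1)
    ≡⟨ cong suc (trans (∑<-const F 1) (*-identityʳ F)) ⟩
  suc F ∎
  where
  open ≡-Reasoning
  F+1≤t+F+1 : ∀ t → suc F ≤ suc (t + suc F)
  F+1≤t+F+1 t = m≤n⇒m≤1+n (m≤n+m (suc F) t)

-- Layer cake: over t < F, 𝟙 (t < a j) and 𝟙 (F ≤ t + b j) sum to a j and b j,
-- so some level t beats the average.
layer-cake-threshold : ∀ n F {a b : ℕ → ℕ} → (∀ j → j < n → a j ≤ F) → (∀ j → j < n → b j ≤ F) →
  pred n * F < ∑< n a + ∑< n b →
  ∃ λ t → t < F × n ≤ count n (λ j → t <ᵇ a j) + count n (λ j → F ≤ᵇ t + b j)
layer-cake-threshold n F {a} {b} a≤F b≤F [n-1]F<∑ with ∑<-pigeonhole F levels F[n-1]<∑levels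
  where
  levels : ℕ → ℕ
  levels t = count n (λ j → t <ᵇ a j) + count n (λ j → F ≤ᵇ t + b j)
  ∑levels : ∑< F levels ≡ ∑< n a + ∑< n b
  ∑levels = begin
    ∑< F levels
      ≡⟨ ∑<-distrib-+ F (λ t → count n (λ j → t <ᵇ a j)) (λ t → count n (λ j → F ≤ᵇ t + b j)) ⟩
    ∑< F (λ t → count n (λ j → t <ᵇ a j)) + ∑< F (λ t → count n (λ j → F ≤ᵇ t + b j))
      ≡⟨ cong₂ _+_ (∑<-comm F n (λ t j → 𝟙 (t <ᵇ a j))) (∑<-comm F n (λ t j → 𝟙 (F ≤ᵇ t + b j))) ⟩
    ∑< n (λ j → count F (_<ᵇ a j)) + ∑< n (λ j → count F (λ t → F ≤ᵇ t + b j))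
      ≡⟨ cong₂ _+_ (∑<-cong n (λ j j<n → count-<ᵇ F (a≤F j j<n))) (∑<-cong n (λ j j<n → count-≤ᵇ-+ F (b≤F j j<n))) ⟩
    ∑< n a + ∑< n b
      ∎
    where open ≡-Reasoning
  F[n-1]<∑levels : F * pred n < ∑< F levels
  F[n-1]<∑levels = subst₂ _<_ (*-comm (pred n) F) (sym ∑levels) [n-1]F<∑
... | t , t<F , n-1<level = t , t<F , pred-<⇒≤ n n-1<level
  where
  pred-<⇒≤ : ∀ n {m} → pred n < m → n ≤ m
  pred-<⇒≤ zero _ = z≤n
  pred-<⇒≤ (suc n) n<m = n<m

length-filter-applyUpTo : ∀ {P : Pred ℕ 0ℓ} (P? : Decidable P) f n →
                          length (filter P? (applyUpTo f n)) ≡ count n (λ i → does (P? (f i)))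
length-filter-applyUpTo P? f zero = refl
length-filter-applyUpTo P? f (suc n) with does (P? (f 0))
... | true = cong suc (length-filter-applyUpTo P? (f ∘ suc) n)
... | false = length-filter-applyUpTo P? (f ∘ suc) n

m+kn≡o+ln⇒m%n≡o%n : ∀ {m o} k l n .{{_ : NonZero n}} → m + k * n ≡ o + l * n → m % n ≡ o % n
m+kn≡o+ln⇒m%n≡o%n {m} {o} k l n eq = begin
  m % n         ≡⟨ [m+kn]%n≡m%n m k n ⟨
  (m + k * n) % n ≡⟨ cong (_% n) eq ⟩
  (o + l * n) % n ≡⟨ [m+kn]%n≡m%n o l n ⟩
  o % n         ∎
  where open ≡-Reasoning

+-congʳ-% : ∀ m {n o} d .{{_ : NonZero d}} → n % d ≡ o % d → (m + n) % d ≡ (m + o) % d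
+-congʳ-% m {n} {o} d eq = begin
  (m + n) % d           ≡⟨ %-distribˡ-+ m n d ⟩
  (m % d + n % d) % d   ≡⟨ cong (λ v → (m % d + v) % d) eq ⟩
  (m % d + o % d) % d   ≡⟨ %-distribˡ-+ m o d ⟨
  (m + o) % d           ∎
  where open ≡-Reasoning

*-congʳ-% : ∀ m {n o} d .{{_ : NonZero d}} → n % d ≡ o % d → (m * n) % d ≡ (m * o) % d
*-congʳ-% m {n} {o} d eq = begin
  (m * n) % d           ≡⟨ %-distribˡ-* m n d ⟩
  (m % d * (n % d)) % d ≡⟨ cong (λ v → (m % d * v) % d) eq ⟩
  (m % d * (o % d)) % d ≡⟨ %-distribˡ-* m o d ⟨
  (m * o) % d           ∎
  where open ≡-Reasoning

[m+n%d]%d≡[m+n]%d : ∀ m n d .{{_ : NonZero d}} → (m + n % d) % d ≡ (m + n) % d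
[m+n%d]%d≡[m+n]%d m n d = +-congʳ-% m d (m%n%n≡m%n n d)

[m+o*[n%d]]%d≡[m+o*n]%d : ∀ m n o d .{{_ : NonZero d}} → (m + o * (n % d)) % d ≡ (m + o * n) % d
[m+o*[n%d]]%d≡[m+o*n]%d m n o d = +-congʳ-% m d (*-congʳ-% o d (m%n%n≡m%n n d))

∃-1+kd≡0-mod-prime : ∀ {p d} .{{_ : NonZero p}} → Prime p → d % p ≢ 0 → ∃ λ k → (1 + k * d) % p ≡ 0
∃-1+kd≡0-mod-prime {0} p-prime = ⊥-elim (¬prime[0] p-prime)
∃-1+kd≡0-mod-prime {1} p-prime = ⊥-elim (¬prime[1] p-prime)
∃-1+kd≡0-mod-prime {p@(suc p-1@(suc _))} {d} p-prime d≢0 =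
  fromBézout (coprime-Bézout (prime⇒coprime p-prime {{≢-nonZero d≢0}} (m%n<n d p)))
  where
  open ≡-Reasoning
  r = d % p
  Q = d / p
  d≡r+Qp : d ≡ r + Q * p
  d≡r+Qp = m≡m%n+[m/n]*n d p
  fromBézout : Bézout.Identity 1 p r → ∃ λ k → (1 + k * d) % p ≡ 0
  fromBézout (Bézout.+- x y 1+yr≡xp) = y , m+kn≡o+ln⇒m%n≡o%n 0 (x + y * Q) p (begin
    1 + y * d + 0               ≡⟨ cong (λ v → 1 + y * v + 0) d≡r+Qp ⟩
    1 + y * (r + Q * p) + 0     ≡⟨ expand y r Q p ⟩
    1 + y * r + y * Q * p       ≡⟨ cong (_+ y * Q * p) 1+yr≡xp ⟩
    x * p + y * Q * p           ≡⟨ collect x y Q p ⟩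
    0 + (x + y * Q) * p         ∎)
    where
    expand : ∀ y r Q p → 1 + y * (r + Q * p) + 0 ≡ 1 + y * r + y * Q * p
    expand = solve-∀
    collect : ∀ x y Q p → x * p + y * Q * p ≡ 0 + (x + y * Q) * p
    collect = solve-∀
  fromBézout (Bézout.-+ x y 1+xp≡yr) = p-1 * y , m+kn≡o+ln⇒m%n≡o%n {o = 0} 0 (1 + p-1 * x + p-1 * y * Q) p (begin
    1 + p-1 * y * d + 0                     ≡⟨ cong (λ v → 1 + p-1 * y * v + 0) d≡r+Qp ⟩
    1 + p-1 * y * (r + Q * p) + 0           ≡⟨ expand p-1 y r Q ⟩
    1 + p-1 * (y * r) + p-1 * y * Q * p     ≡⟨ cong (λ v → 1 + p-1 * v + p-1 * y * Q * p) 1+xp≡yr ⟨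
    1 + p-1 * (1 + x * p) + p-1 * y * Q * p ≡⟨ collect p-1 x y Q ⟩
    0 + (1 + p-1 * x + p-1 * y * Q) * p     ∎)
    where
    expand : ∀ m y r Q → 1 + m * y * (r + Q * suc m) + 0 ≡ 1 + m * (y * r) + m * y * Q * suc m
    expand = solve-∀
    collect : ∀ m x y Q → 1 + m * (1 + x * suc m) + m * y * Q * suc m ≡ 0 + (1 + m * x + m * y * Q) * suc m
    collect = solve-∀

∃-a+kd≡0-mod-prime : ∀ {p d} .{{_ : NonZero p}} → Prime p → d % p ≢ 0 → ∀ a → ∃ λ k → (a + k * d) % p ≡ 0
∃-a+kd≡0-mod-prime {p} {d} p-prime d≢0 a with ∃-1+kd≡0-mod-prime p-prime d≢0
... | k , 1+kd≡0 = a * k , (begin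
  (a + a * k * d) % p     ≡⟨ cong (_% p) (factor a k d) ⟩
  (a * (1 + k * d)) % p   ≡⟨ *-congʳ-% a p (trans 1+kd≡0 (sym 0%p≡0)) ⟩
  (a * 0) % p             ≡⟨ cong (_% p) (*-zeroʳ a) ⟩
  0 % p                   ≡⟨ 0%p≡0 ⟩
  0                       ∎)
  where
  open ≡-Reasoning
  0%p≡0 : 0 % p ≡ 0
  0%p≡0 = m<n⇒m%n≡m (>-nonZero⁻¹ p)
  factor : ∀ a k d → a + a * k * d ≡ a * (1 + k * d)
  factor = solve-∀

∣∧<⇒≡0 : ∀ {m p} → p ∣ m → m < p → m ≡ 0
∣∧<⇒≡0 {zero} _ _ = refl
∣∧<⇒≡0 {suc m} p∣m m<p = ⊥-elim (>⇒∤ m<p p∣m)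

∃-c+en≡0-mod-prime : ∀ {p n} .{{_ : NonZero p}} → Prime p → ¬ p ∣ n → ∀ c → ∃ λ e → e < p × p ∣ c + e * n
∃-c+en≡0-mod-prime {p} {n} p-prime p∤n c with ∃-a+kd≡0-mod-prime p-prime (p∤n ∘ m%n≡0⇒n∣m n p) c
... | k , c+kn≡0 = k % p , m%n<n k p , m%n≡0⇒n∣m _ p (begin
  (c + k % p * n) % p   ≡⟨ cong (λ v → (c + v) % p) (*-comm (k % p) n) ⟩
  (c + n * (k % p)) % p ≡⟨ [m+o*[n%d]]%d≡[m+o*n]%d c k n p ⟩
  (c + n * k) % p       ≡⟨ cong (λ v → (c + v) % p) (*-comm n k) ⟩
  (c + k * n) % p       ≡⟨ c+kn≡0 ⟩
  0                     ∎)
  where open ≡-Reasoning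

c+en≡0-mod-prime-unique-≤ : ∀ {p n c i k} → Prime p → ¬ p ∣ n → i ≤ k → k < p → p ∣ c + i * n → p ∣ c + k * n → k ≡ i
c+en≡0-mod-prime-unique-≤ {p} {n} {c} {i} {k} p-prime p∤n i≤k k<p p∣c+in p∣c+kn
  with euclidsLemma (k ∸ i) n p-prime (∣m+n∣m⇒∣n (subst (p ∣_) split p∣c+kn) p∣c+in)
  where
  split : c + k * n ≡ c + i * n + (k ∸ i) * n
  split = begin
    c + k * n                 ≡⟨ cong (λ v → c + v * n) (m+[n∸m]≡n i≤k) ⟨
    c + (i + (k ∸ i)) * n     ≡⟨ identity c i (k ∸ i) n ⟩
    c + i * n + (k ∸ i) * n   ∎
    where
    open ≡-Reasoning
    identity : ∀ c i d n → c + (i + d) * n ≡ c + i * n + d * n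
    identity = solve-∀
... | inj₂ p∣n = ⊥-elim (p∤n p∣n)
... | inj₁ p∣k∸i = ≤-antisym (m∸n≡0⇒m≤n (∣∧<⇒≡0 p∣k∸i (≤-<-trans (m∸n≤m k i) k<p))) i≤k

c+en≡0-mod-prime-unique : ∀ {p n c e j} → Prime p → ¬ p ∣ n → e < p → j < p → p ∣ c + e * n → p ∣ c + j * n → j ≡ e
c+en≡0-mod-prime-unique {e = e} {j} p-prime p∤n e<p j<p p∣c+en p∣c+jn with ≤-total j e
... | inj₁ j≤e = sym (c+en≡0-mod-prime-unique-≤ p-prime p∤n j≤e e<p p∣c+jn p∣c+en)
... | inj₂ e≤j = c+en≡0-mod-prime-unique-≤ p-prime p∤n e≤j j<p p∣c+en p∣c+jn

-- k + pred p * w represents k − w in ℤ_p.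
[k-w]-shift : ∀ p .{{_ : NonZero p}} k w d → (k + pred p * (w + d) + d) % p ≡ (k + pred p * w) % p
[k-w]-shift (suc m) k w d = m+kn≡o+ln⇒m%n≡o%n 0 d (suc m) (identity k m w d)
  where
  identity : ∀ k m w d → k + m * (w + d) + d + 0 * suc m ≡ k + m * w + d * suc m
  identity = solve-∀

[w+[k-w]]%p≡k%p : ∀ p .{{_ : NonZero p}} k w → (w + (k + pred p * w)) % p ≡ k % p
[w+[k-w]]%p≡k%p (suc m) k w = m+kn≡o+ln⇒m%n≡o%n 0 w (suc m) (identity k m w)
  where
  identity : ∀ k m w → w + (k + m * w) + 0 * suc m ≡ k + w * suc m
  identity = solve-∀

-- The carry J / p of J ≡ k (mod p) turns into a multiple of p n (1 + R).
carry : ∀ s J k p n R .{{_ : NonZero p}} → J % p ≡ k % p →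
        s + J * n + (k / p + R * (J / p)) * (p * n) ≡ s + k * n + J / p * (p * n * suc R)
carry s J k p n R J≡k = begin
  s + J * n + k′ * (p * n)                      ≡⟨ cong (λ v → s + v * n + k′ * (p * n)) (m≡m%n+[m/n]*n J p) ⟩
  s + (J % p + J / p * p) * n + k′ * (p * n)    ≡⟨ cong (λ v → s + (v + J / p * p) * n + k′ * (p * n)) J≡k ⟩
  s + (k % p + J / p * p) * n + k′ * (p * n)    ≡⟨ identity s (k % p) (k / p) (J / p) p n R ⟩
  s + (k % p + k / p * p) * n + J / p * pnR     ≡⟨ cong (λ v → s + v * n + J / p * pnR) (m≡m%n+[m/n]*n k p) ⟨
  s + k * n + J / p * pnR                       ∎
  where
  open ≡-Reasoning
  k′ = k / p + R * (J / p)
  pnR = p * n * suc R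
  identity : ∀ s r b a p n R → s + (r + a * p) * n + (b + R * a) * (p * n) ≡ s + (r + b * p) * n + a * (p * n * suc R)
  identity = solve-∀

-- Sumsets in ℤ_p

InSumset : (p : ℕ) .{{_ : NonZero p}} → (ℕ → Bool) → (ℕ → Bool) → ℕ → Set
InSumset p X Y z = ∃ λ x → ∃ λ y → x < p × y < p × X x ≡ true × Y y ≡ true × (x + y) % p ≡ z % p

module Reflection (p-1 : ℕ) where

  p : ℕ
  p = suc p-1

  -- z − x in ℤ_p, as p-1 ≡ −1
  reflect : ℕ → ℕ → ℕ
  reflect z x = (z + p-1 * x) % p

  reflect-< : ∀ z x → reflect z x < p
  reflect-< z x = m%n<n (z + p-1 * x) p

  reflect-involutive : ∀ z {x} → x < p → reflect z (reflect z x) ≡ x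
  reflect-involutive z {x} x<p = begin
    (z + p-1 * ((z + p-1 * x) % p)) % p ≡⟨ [m+o*[n%d]]%d≡[m+o*n]%d z _ p-1 p ⟩
    (z + p-1 * (z + p-1 * x)) % p       ≡⟨ m+kn≡o+ln⇒m%n≡o%n x (z + p-1 * x) p (identity z x p-1) ⟩
    x % p                               ≡⟨ m<n⇒m%n≡m x<p ⟩
    x                                   ∎
    where
    open ≡-Reasoning
    identity : ∀ z x m → z + m * (z + m * x) + x * suc m ≡ x + (z + m * x) * suc m
    identity = solve-∀

  +-reflect : ∀ z x → (x + reflect z x) % p ≡ z % p
  +-reflect z x = trans ([m+n%d]%d≡[m+n]%d x _ p) (m+kn≡o+ln⇒m%n≡o%n 0 x p (identity z x p-1))
    where
    identity : ∀ z x m → x + (z + m * x) + 0 * suc m ≡ z + x * suc m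
    identity = solve-∀

  reflect-shift : ∀ z d x → reflect (z + d) ((x + d) % p) ≡ reflect z x
  reflect-shift z d x = trans ([m+o*[n%d]]%d≡[m+o*n]%d (z + d) _ p-1 p) (m+kn≡o+ln⇒m%n≡o%n 0 d p (identity z d x p-1))
    where
    identity : ∀ z d x m → z + d + m * (x + d) + 0 * suc m ≡ z + m * x + d * suc m
    identity = solve-∀

  count-reflect : ∀ Y z → count p (Y ∘ reflect z) ≡ count p Y
  count-reflect Y z =
    ∑<-permute p (𝟙 ∘ Y) (λ x _ → reflect-< z x) (λ x _ → reflect-< z x)
      (λ _ → reflect-involutive z) (λ _ → reflect-involutive z)

  inSumset-or-disjoint : ∀ X Y z → InSumset p X Y z ⊎ (∀ x → x < p → X x ∧ Y (reflect z x) ≡ false)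
  inSumset-or-disjoint X Y z with witness-or-none p (λ x → X x ∧ Y (reflect z x))
  ... | inj₂ none = inj₂ none
  ... | inj₁ (x , x<p , Xx∧Yx′) =
    let Xx , Yx′ = ∧-≡-true Xx∧Yx′ in
    inj₁ (x , reflect z x , x<p , reflect-< z x , Xx , Yx′ , +-reflect z x)

  outside-sumset⇒complement : ∀ X Y → p ≤ count p X + count p Y → ∀ z →
    (∀ x → x < p → X x ∧ Y (reflect z x) ≡ false) → ∀ x → x < p → X x ∨ Y (reflect z x) ≡ true
  outside-sumset⇒complement X Y p≤ z =
    count-disjoint-cover p X (Y ∘ reflect z) (subst (λ c → p ≤ count p X + c) (sym (count-reflect Y z)) p≤)

  +d-closed⇒full : ∀ {d} → Prime p → d % p ≢ 0 → (X : ℕ → Bool) →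
    (∀ x → x < p → X x ≡ true → X ((x + d) % p) ≡ true) →
    ∀ {x₀} → x₀ < p → X x₀ ≡ true → ∀ y → y < p → X y ≡ true
  +d-closed⇒full {d} p-prime d≢0 X closed {x₀} x₀<p Xx₀ y y<p =
    subst (λ v → X v ≡ true) x₀+kd≡y (iterate k)
    where
    iterate : ∀ k → X ((x₀ + k * d) % p) ≡ true
    iterate zero = subst (λ v → X v ≡ true) (sym (trans (cong (_% p) (+-identityʳ x₀)) (m<n⇒m%n≡m x₀<p))) Xx₀
    iterate (suc k) = subst (λ v → X v ≡ true) step (closed _ (m%n<n (x₀ + k * d) p) (iterate k))
      where
      step : ((x₀ + k * d) % p + d) % p ≡ (x₀ + suc k * d) % p
      step = begin
        ((x₀ + k * d) % p + d) % p ≡⟨ cong (_% p) (+-comm _ d) ⟩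
        (d + (x₀ + k * d) % p) % p ≡⟨ [m+n%d]%d≡[m+n]%d d _ p ⟩
        (d + (x₀ + k * d)) % p     ≡⟨ cong (_% p) (identity d x₀ k) ⟩
        (x₀ + suc k * d) % p       ∎
        where
        open ≡-Reasoning
        identity : ∀ d x₀ k → d + (x₀ + k * d) ≡ x₀ + suc k * d
        identity = solve-∀
    -- Solve x₀ + k d ≡ y as x₀ + p-1 ⋅ y + k d ≡ 0.
    solution = ∃-a+kd≡0-mod-prime p-prime d≢0 (x₀ + p-1 * y)
    k = proj₁ solution
    a = x₀ + p-1 * y + k * d
    x₀+kd≡y : (x₀ + k * d) % p ≡ y
    x₀+kd≡y = trans (m+kn≡o+ln⇒m%n≡o%n y (a / p) p (begin
      x₀ + k * d + y * p           ≡⟨ identity x₀ k d y p-1 ⟩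
      y + a                        ≡⟨ cong (y +_) (m≡m%n+[m/n]*n a p) ⟩
      y + (a % p + a / p * p)      ≡⟨ cong (λ v → y + (v + a / p * p)) (proj₂ solution) ⟩
      y + a / p * p                ∎)) (m<n⇒m%n≡m y<p)
      where
      open ≡-Reasoning
      identity : ∀ x₀ k d y m → x₀ + k * d + y * suc m ≡ y + (x₀ + m * y + k * d)
      identity = solve-∀

sumset-misses-at-most-one : ∀ {p} .{{_ : NonZero p}} → Prime p → ∀ X Y → p ≤ count p X + count p Y →
  ∀ {e₁ e₂} → e₁ < p → X e₁ ≡ false → e₂ < p → Y e₂ ≡ false →
  ∀ z {d} → 0 < d → d < p → InSumset p X Y z ⊎ InSumset p X Y (z + d)
sumset-misses-at-most-one {zero} p-prime = ⊥-elim (¬prime[0] p-prime)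
sumset-misses-at-most-one {suc p-1} p-prime X Y p≤ {e₁} {e₂} e₁<p Xe₁ e₂<p Ye₂ z {d} 0<d d<p
  with Reflection.inSumset-or-disjoint p-1 X Y z | Reflection.inSumset-or-disjoint p-1 X Y (z + d)
... | inj₁ z∈X+Y | _ = inj₁ z∈X+Y
... | inj₂ _ | inj₁ z+d∈X+Y = inj₂ z+d∈X+Y
-- Otherwise X is the complement of both z − Y and z + d − Y, so it is closed under + d.
... | inj₂ z∉X+Y | inj₂ z+d∉X+Y = ⊥-elim (false≢true (trans (sym Xe₁) (X-full e₁ e₁<p)))
  where
  open Reflection p-1
  false≢true : false ≢ true
  false≢true ()
  complement : ∀ w → (∀ x → x < p → X x ∧ Y (reflect w x) ≡ false) → ∀ x → x < p → X x ∨ Y (reflect w x) ≡ true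
  complement = outside-sumset⇒complement X Y p≤
  closed : ∀ x → x < p → X x ≡ true → X ((x + d) % p) ≡ true
  closed x x<p Xx = ∨-≡-true (complement (z + d) z+d∉X+Y _ (m%n<n (x + d) p))
    (trans (cong Y (reflect-shift z d x)) (∧-≡-false (z∉X+Y x x<p) Xx))
  X-full : ∀ y → y < p → X y ≡ true
  X-full = +d-closed⇒full p-prime (λ d%p≡0 → <-irrefl (trans (sym d%p≡0) (m<n⇒m%n≡m d<p)) 0<d) X closed (reflect-< z e₂)
    (∨-≡-true (complement z z∉X+Y _ (reflect-< z e₂)) (trans (cong Y (reflect-involutive z e₂<p)) Ye₂))

-- Residue classes modulo n and p n

c+jn<pn : ∀ {c j n p} → c < n → j < p → c + j * n < p * n
c+jn<pn {c} {j} {n} c<n j<p = <-≤-trans (+-monoˡ-< (j * n) c<n) (*-monoˡ-≤ n j<p)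

m%[p*n]≡m%n+m/n%p*n : ∀ m p n .{{_ : NonZero p}} .{{_ : NonZero n}} .{{_ : NonZero (p * n)}} →
                      m % (p * n) ≡ m % n + m / n % p * n
m%[p*n]≡m%n+m/n%p*n m p n = begin
  m % (p * n)                   ≡⟨ cong (_% (p * n)) (trans (m≡m%n+[m/n]*n m n) (+-comm (m % n) _)) ⟩
  (m / n * n + m % n) % (p * n) ≡⟨ [m*n+o]%[p*n]≡[m*n]%[p*n]+o (m / n) p (m%n<n m n) ⟩
  m / n * n % (p * n) + m % n   ≡⟨ cong (_+ m % n) (m%n*o≡m*o%[n*o] (m / n) p n) ⟨
  m / n % p * n + m % n         ≡⟨ +-comm _ (m % n) ⟩
  m % n + m / n % p * n         ∎
  where open ≡-Reasoning

digits-≡ᵇ : ∀ {a c} d j n .{{_ : NonZero n}} → a < n → c < n → (a + d * n ≡ᵇ c + j * n) ≡ ((a ≡ᵇ c) ∧ (j ≡ᵇ d))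
digits-≡ᵇ {a} {c} d j n a<n c<n with a ≟ c | j ≟ d
... | yes refl | yes refl =
  trans (≡⇒≡ᵇ≡true {a + d * n} refl) (sym (cong₂ _∧_ (≡⇒≡ᵇ≡true {a} refl) (≡⇒≡ᵇ≡true {j} refl)))
... | no a≢c | _ = trans (≢⇒≡ᵇ≡false (a≢c ∘ low-digit)) (sym (cong (_∧ (j ≡ᵇ d)) (≢⇒≡ᵇ≡false a≢c)))
  where
  low-digit : a + d * n ≡ c + j * n → a ≡ c
  low-digit eq = begin
    a               ≡⟨ m<n⇒m%n≡m a<n ⟨
    a % n           ≡⟨ m+kn≡o+ln⇒m%n≡o%n d j n eq ⟩
    c % n           ≡⟨ m<n⇒m%n≡m c<n ⟩
    c               ∎
    where open ≡-Reasoning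
... | yes refl | no j≢d =
  trans (≢⇒≡ᵇ≡false (j≢d ∘ sym ∘ high-digit)) (sym (trans (cong (_∧ (j ≡ᵇ d)) (≡⇒≡ᵇ≡true {a} refl)) (≢⇒≡ᵇ≡false j≢d)))
  where
  high-digit : a + d * n ≡ a + j * n → d ≡ j
  high-digit eq = *-cancelʳ-≡ d j n (+-cancelˡ-≡ a _ _ eq)

inClass : (n : ℕ) .{{_ : NonZero n}} → ℕ → ℕ → Bool
inClass n c x = x % n ≡ᵇ c

inClass-refine : ∀ p n .{{_ : NonZero p}} .{{_ : NonZero n}} .{{_ : NonZero (p * n)}} → ∀ {c} j x → c < n →
                 inClass (p * n) (c + j * n) x ≡ inClass n c x ∧ (j ≡ᵇ x / n % p)
inClass-refine p n {c} j x c<n =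
  trans (cong (_≡ᵇ c + j * n) (m%[p*n]≡m%n+m/n%p*n x p n)) (digits-≡ᵇ (x / n % p) j n (m%n<n x n) c<n)

count-inClass-refine : ∀ N p n .{{_ : NonZero p}} .{{_ : NonZero n}} .{{_ : NonZero (p * n)}} → ∀ (S : ℕ → Bool) {c} → c < n →
  count N (λ x → S x ∧ inClass n c x) ≡ ∑< p (λ j → count N (λ x → S x ∧ inClass (p * n) (c + j * n) x))
count-inClass-refine N p n S {c} c<n =
  trans (∑<-cong N (λ x _ → spread x)) (∑<-comm N p (λ x j → 𝟙 (S x ∧ inClass (p * n) (c + j * n) x)))
  where
  spread : ∀ x → 𝟙 (S x ∧ inClass n c x) ≡ ∑< p (λ j → 𝟙 (S x ∧ inClass (p * n) (c + j * n) x))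
  spread x = trans (𝟙-spread (S x ∧ inClass n c x) (m%n<n (x / n) p)) (∑<-cong p λ j _ → cong 𝟙 (begin
    (S x ∧ inClass n c x) ∧ (j ≡ᵇ x / n % p)  ≡⟨ ∧-assoc (S x) _ _ ⟩
    S x ∧ (inClass n c x ∧ (j ≡ᵇ x / n % p))  ≡⟨ cong (S x ∧_) (inClass-refine p n j x c<n) ⟨
    S x ∧ inClass (p * n) (c + j * n) x       ∎))
    where open ≡-Reasoning

-- Units of ℤ_q in residue classes

coprime-* : ∀ {a m n} → Coprime a m → Coprime a n → Coprime a (m * n)
coprime-* {a} {m} a⊥m a⊥n {d} (d∣a , d∣mn) = a⊥n (d∣a , coprime-divisor d⊥m d∣mn)
  where
  d⊥m : Coprime d m
  d⊥m (e∣d , e∣m) = a⊥m (∣-trans e∣d d∣a , e∣m)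

coprime-+* : ∀ {c n} j → Coprime c n → Coprime (c + j * n) n
coprime-+* {c} {n} j c⊥n {d} (d∣c+jn , d∣n) =
  c⊥n (∣m+n∣m⇒∣n (subst (d ∣_) (+-comm c (j * n)) d∣c+jn) (∣n⇒∣m*n j d∣n) , d∣n)

∤-prime⇒coprime : ∀ {a p} → Prime p → ¬ p ∣ a → Coprime a p
∤-prime⇒coprime p-prime p∤a {d} (d∣a , d∣p) with prime⇒irreducible p-prime d∣p
... | inj₁ d≡1 = d≡1
... | inj₂ refl = ⊥-elim (p∤a d∣a)

odd-prime>2 : ∀ {p q} → ¬ 2 ∣ q → Prime p → p ∣ q → 2 < p
odd-prime>2 {0} _ p-prime = ⊥-elim (¬prime[0] p-prime)
odd-prime>2 {1} _ p-prime = ⊥-elim (¬prime[1] p-prime)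
odd-prime>2 {2} q-odd _ 2∣q = ⊥-elim (q-odd 2∣q)
odd-prime>2 {suc (suc (suc _))} _ _ _ = s≤s (s≤s (s≤s z≤n))

φ∏ : List ℕ → ℕ
φ∏ [] = 1
φ∏ (p ∷ ps) = pred p * φ∏ ps

module UnitClasses (q : ℕ) .{{_ : NonZero q}} (q-squarefree : SquareFree q) where

  isUnit : ℕ → Bool
  isUnit x = does (coprime? x q)

  isUnit⇒coprime : ∀ {x} → isUnit x ≡ true → Coprime x q
  isUnit⇒coprime {x} = witness (coprime? x q)
    where
    witness : ∀ {P : Set} (P? : Dec P) → does P? ≡ true → P
    witness (yes p) _ = p

  coprime⇒isUnit : ∀ {x} → Coprime x q → isUnit x ≡ true
  coprime⇒isUnit {x} = dec-true (coprime? x q)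

  unitsIn : (n : ℕ) .{{_ : NonZero n}} → ℕ → ℕ
  unitsIn n c = count q (λ x → isUnit x ∧ inClass n c x)

  inClass-q⇒≡ : ∀ {n} .{{_ : NonZero n}} → n ≡ q → ∀ {c x} → x < q → inClass n c x ≡ true → x ≡ c
  inClass-q⇒≡ {n} refl {c} {x} x<q x∈c = trans (sym (m<n⇒m%n≡m x<q)) (≡ᵇ≡true⇒≡ x∈c)

  module Refinement {n p R} .{{_ : NonZero n}} (p-prime : Prime p) (n*pR≡q : n * (p * R) ≡ q) where

    instance
      p≢0 : NonZero p
      p≢0 = prime⇒nonZero p-prime
      pn≢0 : NonZero (p * n)
      pn≢0 = m*n≢0 p n

    pn*R≡q : p * n * R ≡ q
    pn*R≡q = trans (identity p n R) n*pR≡q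
      where
      identity : ∀ p n R → p * n * R ≡ n * (p * R)
      identity = solve-∀

    p∤n : ¬ p ∣ n
    p∤n (divides k refl) = q-squarefree p p-prime (divides (k * R) (trans (sym n*pR≡q) (identity k p R)))
      where
      identity : ∀ k p R → k * p * (p * R) ≡ k * R * (p * p)
      identity = solve-∀

    p∣q : p ∣ q
    p∣q = divides (n * R) (trans (sym n*pR≡q) (identity n p R))
      where
      identity : ∀ n p R → n * (p * R) ≡ n * R * p
      identity = solve-∀

    unit-free-index : ∀ c → ∃ λ e → e < p × p ∣ c + e * n
    unit-free-index = ∃-c+en≡0-mod-prime p-prime p∤n

    no-units-in-class : ∀ {c} → p ∣ c → ∀ x → isUnit x ∧ inClass (p * n) c x ≡ false
    no-units-in-class {c} p∣c x with isUnit x in x-unit | inClass (p * n) c x in x∈c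
    ... | false | _ = refl
    ... | true | false = refl
    ... | true | true = ⊥-elim (¬prime[1] (subst Prime p≡1 p-prime))
      where
      p∣x : p ∣ x
      p∣x = ∣n∣m%n⇒∣m (m∣m*n n) (subst (p ∣_) (sym (≡ᵇ≡true⇒≡ x∈c)) p∣c)
      p≡1 : p ≡ 1
      p≡1 = isUnit⇒coprime x-unit (p∣x , p∣q)

    unitsIn-refine : ∀ {c} → c < n → unitsIn n c ≡ ∑< p (λ j → unitsIn (p * n) (c + j * n))
    unitsIn-refine = count-inClass-refine q p n isUnit

  unitsIn-≤ : ∀ ps n .{{_ : NonZero n}} → All Prime ps → n * product ps ≡ q → ∀ {c} → c < n → unitsIn n c ≤ φ∏ ps
  unitsIn-≤ [] n [] n*1≡q {c} c<n = ≤-trans (count-mono q at-most-c) (count-≡ᵇ-≤1 q c)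
    where
    at-most-c : ∀ x → x < q → isUnit x ∧ inClass n c x ≡ true → (x ≡ᵇ c) ≡ true
    at-most-c x x<q x∈c = ≡⇒≡ᵇ≡true (inClass-q⇒≡ (trans (sym (*-identityʳ n)) n*1≡q) x<q (proj₂ (∧-≡-true x∈c)))
  unitsIn-≤ (p ∷ ps) n (p-prime ∷ ps-prime) n*pR≡q {c} c<n
    with e , e<p , p∣c+en ← Refinement.unit-free-index p-prime n*pR≡q c = begin
    unitsIn n c                              ≡⟨ unitsIn-refine c<n ⟩
    ∑< p (λ j → unitsIn (p * n) (c + j * n)) ≤⟨ ∑<-≤-except p _ refined-≤ e<p unit-free ⟩
    pred p * φ∏ ps                           ∎
    where
    open Refinement p-prime n*pR≡q
    open ≤-Reasoning
    refined-≤ : ∀ j → j < p → unitsIn (p * n) (c + j * n) ≤ φ∏ ps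
    refined-≤ j j<p = unitsIn-≤ ps (p * n) ps-prime pn*R≡q (c+jn<pn c<n j<p)
    unit-free : unitsIn (p * n) (c + e * n) ≡ 0
    unit-free = count-none q _ (λ x _ → no-units-in-class p∣c+en x)

  count-isUnit≡φ : count q isUnit ≡ φ q
  count-isUnit≡φ = sym (length-filter-applyUpTo (λ x → coprime? x q) (λ x → x) q)

  unitsIn-1-0≡φ : unitsIn 1 0 ≡ φ q
  unitsIn-1-0≡φ = trans (∑<-cong q (λ x _ → cong 𝟙 (everything-in-class-0 x))) count-isUnit≡φ
    where
    everything-in-class-0 : ∀ x → isUnit x ∧ inClass 1 0 x ≡ isUnit x
    everything-in-class-0 x = trans (cong (isUnit x ∧_) (≡⇒≡ᵇ≡true (n%1≡0 x))) (∧-identityʳ (isUnit x))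

  unitsIn-≥ : ∀ ps n .{{_ : NonZero n}} → All Prime ps → n * product ps ≡ q → ∀ {c} → c < n → Coprime c n → φ∏ ps ≤ unitsIn n c
  unitsIn-≥ [] n [] n*1≡q {c} c<n c⊥n = begin
    1                            ≡⟨ cong 𝟙 c∈c ⟨
    𝟙 (isUnit c ∧ inClass n c c) ≤⟨ ∑<-≥-term q (λ x → 𝟙 (isUnit x ∧ inClass n c x)) (subst (c <_) n≡q c<n) ⟩
    unitsIn n c                  ∎
    where
    open ≤-Reasoning
    n≡q : n ≡ q
    n≡q = trans (sym (*-identityʳ n)) n*1≡q
    c∈c : isUnit c ∧ inClass n c c ≡ true
    c∈c = cong₂ _∧_ (coprime⇒isUnit (subst (Coprime c) n≡q c⊥n)) (≡⇒≡ᵇ≡true (m<n⇒m%n≡m c<n))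
  unitsIn-≥ (p ∷ ps) n (p-prime ∷ ps-prime) n*pR≡q {c} c<n c⊥n
    with e , e<p , p∣c+en ← Refinement.unit-free-index p-prime n*pR≡q c = begin
    pred p * φ∏ ps                           ≤⟨ ∑<-≥-except p _ refined-≥ e<p ⟩
    ∑< p (λ j → unitsIn (p * n) (c + j * n)) ≡⟨ unitsIn-refine c<n ⟨
    unitsIn n c                              ∎
    where
    open Refinement p-prime n*pR≡q
    open ≤-Reasoning
    c+jn⊥pn : ∀ {j} → j < p → j ≢ e → Coprime (c + j * n) (p * n)
    c+jn⊥pn {j} j<p j≢e =
      coprime-* (∤-prime⇒coprime p-prime (j≢e ∘ c+en≡0-mod-prime-unique p-prime p∤n e<p j<p p∣c+en)) (coprime-+* j c⊥n)
    refined-≥ : ∀ j → j < p → j ≢ e → φ∏ ps ≤ unitsIn (p * n) (c + j * n)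
    refined-≥ j j<p j≢e = unitsIn-≥ ps (p * n) ps-prime pn*R≡q (c+jn<pn c<n j<p) (c+jn⊥pn j<p j≢e)

  φ∏≤φ : ∀ ps → All Prime ps → product ps ≡ q → φ∏ ps ≤ φ q
  φ∏≤φ ps ps-prime ∏ps≡q = begin
    φ∏ ps       ≤⟨ unitsIn-≥ ps 1 ps-prime (trans (*-identityˡ (product ps)) ∏ps≡q) z<s (coprime-sym (1-coprimeTo 0)) ⟩
    unitsIn 1 0 ≡⟨ unitsIn-1-0≡φ ⟩
    φ q         ∎
    where open ≤-Reasoning

-- Four-fold sums

both-positive : ∀ {a b} → a ≤ 1 → b ≤ 1 → 1 < a + b → 0 < a × 0 < b
both-positive {suc a} {suc b} _ _ _ = z<s , z<s
both-positive {zero} _ b≤1 1<b = ⊥-elim (<⇒≱ 1<b b≤1)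
both-positive {suc a} {zero} a≤1 _ 1<a+0 = ⊥-elim (<⇒≱ 1<a+0 (subst (_≤ 1) (sym (+-identityʳ (suc a))) a≤1))

three-way-meet : ∀ {G₀ G₁ G₂ H₀ H₁ H₂ : Set} → G₀ ⊎ G₁ → G₀ ⊎ G₂ → G₁ ⊎ G₂ → H₀ ⊎ H₁ → H₀ ⊎ H₂ → H₁ ⊎ H₂ →
                 (G₀ × H₀) ⊎ (G₁ × H₁) ⊎ (G₂ × H₂)
three-way-meet (inj₁ g₀) _ _ (inj₁ h₀) _ _ = inj₁ (g₀ , h₀)
three-way-meet (inj₁ g₀) _ _ (inj₂ _) (inj₁ h₀) _ = inj₁ (g₀ , h₀)
three-way-meet (inj₁ _) _ (inj₁ g₁) (inj₂ h₁) (inj₂ _) _ = inj₂ (inj₁ (g₁ , h₁))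
three-way-meet (inj₁ _) _ (inj₂ g₂) (inj₂ _) (inj₂ h₂) _ = inj₂ (inj₂ (g₂ , h₂))
three-way-meet (inj₂ g₁) _ _ (inj₂ h₁) _ _ = inj₂ (inj₁ (g₁ , h₁))
three-way-meet (inj₂ _) (inj₁ g₀) _ (inj₁ h₀) _ _ = inj₁ (g₀ , h₀)
three-way-meet (inj₂ g₁) (inj₂ _) _ (inj₁ _) _ (inj₁ h₁) = inj₂ (inj₁ (g₁ , h₁))
three-way-meet (inj₂ _) (inj₂ g₂) _ (inj₁ _) _ (inj₂ h₂) = inj₂ (inj₂ (g₂ , h₂))

memberᵇ : ∀ {n} → Subset n → ℕ → Bool
memberᵇ [] _ = false
memberᵇ (b ∷ A) zero = b
memberᵇ (b ∷ A) (suc x) = memberᵇ A x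

memberᵇ⇒∈ : ∀ {n} (A : Subset n) (x : Fin n) → memberᵇ A (toℕ x) ≡ true → x ∈ A
memberᵇ⇒∈ (true ∷ A) Fin.zero refl = here
memberᵇ⇒∈ (b ∷ A) (Fin.suc x) x∈A = there (memberᵇ⇒∈ A x x∈A)

memberᵇ⇒∈-fromℕ< : ∀ {n} (A : Subset n) {x} (x<n : x < n) → memberᵇ A x ≡ true → fromℕ< x<n ∈ A
memberᵇ⇒∈-fromℕ< A x<n x∈A = memberᵇ⇒∈ A (fromℕ< x<n) (subst (λ y → memberᵇ A y ≡ true) (sym (toℕ-fromℕ< x<n)) x∈A)

∣A∣≡count-memberᵇ : ∀ {n} (A : Subset n) → ∣ A ∣ ≡ count n (memberᵇ A)
∣A∣≡count-memberᵇ [] = refl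
∣A∣≡count-memberᵇ (true ∷ A) = cong suc (∣A∣≡count-memberᵇ A)
∣A∣≡count-memberᵇ (false ∷ A) = ∣A∣≡count-memberᵇ A

module FourfoldSums (q : ℕ) .{{_ : NonZero q}} (q-squarefree : SquareFree q) where

  open UnitClasses q q-squarefree

  record UnitClassSubset (n : ℕ) .{{_ : NonZero n}} : Set where
    field
      rep : ℕ
      rep<n : rep < n
      members : ℕ → Bool
      members⊆class : ∀ x → x < q → members x ≡ true → isUnit x ∧ inClass n rep x ≡ true

  open UnitClassSubset

  size : ∀ {n} .{{_ : NonZero n}} → UnitClassSubset n → ℕ
  size S = count q (members S)

  size-≤ : ∀ ps n .{{_ : NonZero n}} → All Prime ps → n * product ps ≡ q → (S : UnitClassSubset n) → size S ≤ φ∏ ps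
  size-≤ ps n ps-prime n*R≡q S = ≤-trans (count-mono q (members⊆class S)) (unitsIn-≤ ps n ps-prime n*R≡q (rep<n S))

  Member : (ℕ → Bool) → ℕ → Set
  Member A x = x < q × A x ≡ true

  record FourfoldSum (A₁ A₂ A₃ A₄ : ℕ → Bool) (z : ℕ) : Set where
    constructor fourfoldSum
    field
      {a₁ a₂ a₃ a₄} : ℕ
      a₁∈A₁ : Member A₁ a₁
      a₂∈A₂ : Member A₂ a₂
      a₃∈A₃ : Member A₃ a₃
      a₄∈A₄ : Member A₄ a₄
      sum≡z : (a₁ + a₂ + a₃ + a₄) % q ≡ z % q

  _⊆ᵇ_ : (ℕ → Bool) → (ℕ → Bool) → Set
  B ⊆ᵇ A = ∀ {x} → B x ≡ true → A x ≡ true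

  fourfoldSum-⊆ : ∀ {A₁ A₂ A₃ A₄ B₁ B₂ B₃ B₄ z z′} → B₁ ⊆ᵇ A₁ → B₂ ⊆ᵇ A₂ → B₃ ⊆ᵇ A₃ → B₄ ⊆ᵇ A₄ →
                  z % q ≡ z′ % q → FourfoldSum B₁ B₂ B₃ B₄ z → FourfoldSum A₁ A₂ A₃ A₄ z′
  fourfoldSum-⊆ ⊆₁ ⊆₂ ⊆₃ ⊆₄ z≡z′ (fourfoldSum (a₁<q , a₁∈B₁) (a₂<q , a₂∈B₂) (a₃<q , a₃∈B₃) (a₄<q , a₄∈B₄) sum≡z) =
    fourfoldSum (a₁<q , ⊆₁ a₁∈B₁) (a₂<q , ⊆₂ a₂∈B₂) (a₃<q , ⊆₃ a₃∈B₃) (a₄<q , ⊆₄ a₄∈B₄) (trans sum≡z z≡z′)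

  Reachable : List ℕ → (n : ℕ) .{{_ : NonZero n}} → Set
  Reachable ps n = (S₁ S₂ S₃ S₄ : UnitClassSubset n) → φ∏ ps < size S₁ + size S₂ → φ∏ ps < size S₃ + size S₄ →
    ∀ k → FourfoldSum (members S₁) (members S₂) (members S₃) (members S₄) (rep S₁ + rep S₂ + rep S₃ + rep S₄ + k * n)

  -- Modulo q every class holds at most one unit, so each Sᵢ is {rep Sᵢ}.
  reachable-[] : ∀ n .{{_ : NonZero n}} → n * product [] ≡ q → Reachable [] n
  reachable-[] n n*1≡q S₁ S₂ S₃ S₄ 1<s₁+s₂ 1<s₃+s₄ k =
    fourfoldSum (rep∈ S₁ 0<s₁) (rep∈ S₂ 0<s₂) (rep∈ S₃ 0<s₃) (rep∈ S₄ 0<s₄) (sym kn-vanishes)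
    where
    Σrep = rep S₁ + rep S₂ + rep S₃ + rep S₄
    n≡q : n ≡ q
    n≡q = trans (sym (*-identityʳ n)) n*1≡q
    kn-vanishes : (Σrep + k * n) % q ≡ Σrep % q
    kn-vanishes = trans (cong (λ m → (Σrep + k * m) % q) n≡q) ([m+kn]%n≡m%n Σrep k q)
    rep∈ : (S : UnitClassSubset n) → 0 < size S → Member (members S) (rep S)
    rep∈ S 0<s with count-witness q (members S) 0<s
    ... | x , x<q , x∈S =
      subst (Member (members S)) (inClass-q⇒≡ n≡q x<q (proj₂ (∧-≡-true (members⊆class S x x<q x∈S)))) (x<q , x∈S)
    nonempty : ∀ S T → 1 < size S + size T → 0 < size S × 0 < size T
    nonempty S T = both-positive (size-≤ [] n [] n*1≡q S) (size-≤ [] n [] n*1≡q T)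
    0<s₁ = proj₁ (nonempty S₁ S₂ 1<s₁+s₂)
    0<s₂ = proj₂ (nonempty S₁ S₂ 1<s₁+s₂)
    0<s₃ = proj₁ (nonempty S₃ S₄ 1<s₃+s₄)
    0<s₄ = proj₂ (nonempty S₃ S₄ 1<s₃+s₄)

  module Step {p ps n} .{{_ : NonZero n}} (p-prime : Prime p) (2<p : 2 < p) (ps-prime : All Prime ps)
              (n*pR≡q : n * (p * product ps) ≡ q) where

    open Refinement p-prime n*pR≡q

    fibre : UnitClassSubset n → ℕ → ℕ → Bool
    fibre S j x = members S x ∧ inClass (p * n) (rep S + j * n) x

    fibreSize : UnitClassSubset n → ℕ → ℕ
    fibreSize S j = count q (fibre S j)

    refine : (S : UnitClassSubset n) → ∀ {j} → j < p → UnitClassSubset (p * n)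
    refine S {j} j<p = record
      { rep = rep S + j * n
      ; rep<n = c+jn<pn (rep<n S) j<p
      ; members = fibre S j
      ; members⊆class = λ x x<q x∈fibre →
          let x∈S , x∈class = ∧-≡-true x∈fibre in
          cong₂ _∧_ (proj₁ (∧-≡-true (members⊆class S x x<q x∈S))) x∈class
      }

    fibreSize-≤ : ∀ S {j} → j < p → fibreSize S j ≤ φ∏ ps
    fibreSize-≤ S j<p = size-≤ ps (p * n) ps-prime pn*R≡q (refine S j<p)

    size≡∑fibreSize : ∀ S → size S ≡ ∑< p (fibreSize S)
    size≡∑fibreSize S = trans (∑<-cong q within-class) (count-inClass-refine q p n (members S) (rep<n S))
      where
      within-class : ∀ x → x < q → 𝟙 (members S x) ≡ 𝟙 (members S x ∧ inClass n (rep S) x)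
      within-class x x<q with members S x in x∈S
      ... | false = refl
      ... | true = cong 𝟙 (sym (proj₂ (∧-≡-true (members⊆class S x x<q x∈S))))

    unit-free : UnitClassSubset n → ℕ
    unit-free S = proj₁ (unit-free-index (rep S))

    unit-free<p : ∀ S → unit-free S < p
    unit-free<p S = proj₁ (proj₂ (unit-free-index (rep S)))

    p∣unit-free : ∀ S → p ∣ rep S + unit-free S * n
    p∣unit-free S = proj₂ (proj₂ (unit-free-index (rep S)))

    fibreSize-unit-free : ∀ S → fibreSize S (unit-free S) ≡ 0
    fibreSize-unit-free S = n≤0⇒n≡0 (begin
      fibreSize S (unit-free S)                  ≤⟨ count-mono q (members⊆class (refine S (unit-free<p S))) ⟩
      unitsIn (p * n) (rep S + unit-free S * n)  ≡⟨ count-none q _ (λ x _ → no-units-in-class (p∣unit-free S) x) ⟩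
      0                                          ∎)
      where open ≤-Reasoning

    record Split (S T : UnitClassSubset n) (z : ℕ) : Set where
      constructor split
      field
        {j₁ j₂} : ℕ
        j₁<p : j₁ < p
        j₂<p : j₂ < p
        j₁+j₂≡z : (j₁ + j₂) % p ≡ z % p
        large : φ∏ ps < fibreSize S j₁ + fibreSize T j₂

    split-cong : ∀ {S T z z′} → z % p ≡ z′ % p → Split S T z → Split S T z′
    split-cong z≡z′ (split j₁<p j₂<p j₁+j₂≡z large) = split j₁<p j₂<p (trans j₁+j₂≡z z≡z′) large

    -- Thresholding the fibre sizes of S and T turns them into sets X, Y ⊆ ℤ_p with |X| + |Y| ≥ p,
    -- each missing the unit-free fibre, and every point of X + Y gives a split.
    split-or-shifted-split : ∀ S T → φ∏ (p ∷ ps) < size S + size T →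
                             ∀ z {d} → 0 < d → d < p → Split S T z ⊎ Split S T (z + d)
    split-or-shifted-split S T large z 0<d d<p =
      Sum.map toSplit toSplit (sumset-misses-at-most-one p-prime X Y p≤|X|+|Y| (unit-free<p S) X-misses (unit-free<p T) Y-misses z 0<d d<p)
      where
      threshold = layer-cake-threshold p (φ∏ ps) (λ _ → fibreSize-≤ S) (λ _ → fibreSize-≤ T)
                    (subst₂ (λ a b → pred p * φ∏ ps < a + b) (size≡∑fibreSize S) (size≡∑fibreSize T) large)
      t = proj₁ threshold
      t<φ = proj₁ (proj₂ threshold)
      X Y : ℕ → Bool
      X j = t <ᵇ fibreSize S j
      Y j = φ∏ ps ≤ᵇ t + fibreSize T j
      p≤|X|+|Y| : p ≤ count p X + count p Y
      p≤|X|+|Y| = proj₂ (proj₂ threshold)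
      X-misses : X (unit-free S) ≡ false
      X-misses = cong (t <ᵇ_) (fibreSize-unit-free S)
      Y-misses : Y (unit-free T) ≡ false
      Y-misses = trans (cong (λ v → φ∏ ps ≤ᵇ t + v) (fibreSize-unit-free T))
                       (>⇒≤ᵇ≡false (subst (_< φ∏ ps) (sym (+-identityʳ t)) t<φ))
      toSplit : ∀ {w} → InSumset p X Y w → Split S T w
      toSplit (x , y , x<p , y<p , Xx , Yy , x+y≡w) =
        split x<p y<p x+y≡w (≤-<-trans (≤ᵇ≡true⇒≤ Yy) (+-monoˡ-< (fibreSize T y) (<ᵇ≡true⇒< Xx)))

    digit-sum : ∀ j₁ j₂ j₃ j₄ {w k} → (j₁ + j₂) % p ≡ w % p → (j₃ + j₄) % p ≡ (k + pred p * w) % p →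
                (j₁ + j₂ + j₃ + j₄) % p ≡ k % p
    digit-sum j₁ j₂ j₃ j₄ {w} {k} j₁+j₂≡w j₃+j₄≡k-w = begin
      (j₁ + j₂ + j₃ + j₄) % p              ≡⟨ cong (_% p) (+-assoc (j₁ + j₂) j₃ j₄) ⟩
      (j₁ + j₂ + (j₃ + j₄)) % p            ≡⟨ %-distribˡ-+ (j₁ + j₂) (j₃ + j₄) p ⟩
      ((j₁ + j₂) % p + (j₃ + j₄) % p) % p  ≡⟨ cong₂ (λ a b → (a + b) % p) j₁+j₂≡w j₃+j₄≡k-w ⟩
      (w % p + (k + pred p * w) % p) % p   ≡⟨ %-distribˡ-+ w _ p ⟨
      (w + (k + pred p * w)) % p           ≡⟨ [w+[k-w]]%p≡k%p p k w ⟩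
      k % p                                ∎
      where open ≡-Reasoning

    lift-target : ∀ c₁ c₂ c₃ c₄ j₁ j₂ j₃ j₄ k → (j₁ + j₂ + j₃ + j₄) % p ≡ k % p →
      ((c₁ + j₁ * n) + (c₂ + j₂ * n) + (c₃ + j₃ * n) + (c₄ + j₄ * n)
        + (k / p + pred (product ps) * ((j₁ + j₂ + j₃ + j₄) / p)) * (p * n)) % q
      ≡ (c₁ + c₂ + c₃ + c₄ + k * n) % q
    lift-target c₁ c₂ c₃ c₄ j₁ j₂ j₃ j₄ k J≡k = m+kn≡o+ln⇒m%n≡o%n 0 (J / p) q (begin
      c₁ + j₁ * n + (c₂ + j₂ * n) + (c₃ + j₃ * n) + (c₄ + j₄ * n) + k′ * (p * n) + 0 * q
        ≡⟨ +-identityʳ _ ⟩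
      c₁ + j₁ * n + (c₂ + j₂ * n) + (c₃ + j₃ * n) + (c₄ + j₄ * n) + k′ * (p * n)
        ≡⟨ regroup c₁ c₂ c₃ c₄ j₁ j₂ j₃ j₄ n (k′ * (p * n)) ⟩
      Σc + J * n + k′ * (p * n)
        ≡⟨ carry Σc J k p n (pred R) J≡k ⟩
      Σc + k * n + J / p * (p * n * suc (pred R))
        ≡⟨ cong (λ v → Σc + k * n + J / p * (p * n * v)) (suc-pred R) ⟩
      Σc + k * n + J / p * (p * n * R)
        ≡⟨ cong (λ v → Σc + k * n + J / p * v) pn*R≡q ⟩
      Σc + k * n + J / p * q
        ∎)
      where
      open ≡-Reasoning
      instance _ = productOfPrimes≢0 ps-prime
      R = product ps
      J = j₁ + j₂ + j₃ + j₄
      Σc = c₁ + c₂ + c₃ + c₄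
      k′ = k / p + pred R * (J / p)
      regroup : ∀ c₁ c₂ c₃ c₄ j₁ j₂ j₃ j₄ n x →
        c₁ + j₁ * n + (c₂ + j₂ * n) + (c₃ + j₃ * n) + (c₄ + j₄ * n) + x ≡ c₁ + c₂ + c₃ + c₄ + (j₁ + j₂ + j₃ + j₄) * n + x
      regroup = solve-∀

    reachable-step : Reachable ps (p * n) → Reachable (p ∷ ps) n
    reachable-step ih S₁ S₂ S₃ S₄ large₁₂ large₃₄ k =
      [ lift , [ lift , lift ]′ ]′ (three-way-meet (G 0 0 1<p) (G 0 1 2<p) (G 1 0 1<p) (H 0 0 1<p) (H 0 1 2<p) (H 1 0 1<p))
      where
      1<p : 1 < p
      1<p = <-trans ≤-refl 2<p
      k- : ℕ → ℕ
      k- w = k + pred p * w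
      G : ∀ w d → suc d < p → Split S₁ S₂ w ⊎ Split S₁ S₂ (w + suc d)
      G w d 1+d<p = split-or-shifted-split S₁ S₂ large₁₂ w z<s 1+d<p
      H : ∀ w d → suc d < p → Split S₃ S₄ (k- w) ⊎ Split S₃ S₄ (k- (w + suc d))
      H w d 1+d<p = Sum.swap (Sum.map₂ (split-cong ([k-w]-shift p k w (suc d)))
                      (split-or-shifted-split S₃ S₄ large₃₄ (k- (w + suc d)) z<s 1+d<p))
      fibre⊆ : ∀ S j → fibre S j ⊆ᵇ members S
      fibre⊆ S j = proj₁ ∘ ∧-≡-true
      lift : ∀ {w} → Split S₁ S₂ w × Split S₃ S₄ (k- w) →
             FourfoldSum (members S₁) (members S₂) (members S₃) (members S₄) (rep S₁ + rep S₂ + rep S₃ + rep S₄ + k * n)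
      lift (split {j₁} {j₂} j₁<p j₂<p j₁+j₂≡w large₁₂′ , split {j₃} {j₄} j₃<p j₄<p j₃+j₄≡k-w large₃₄′) =
        fourfoldSum-⊆ (fibre⊆ S₁ j₁) (fibre⊆ S₂ j₂) (fibre⊆ S₃ j₃) (fibre⊆ S₄ j₄)
          (lift-target (rep S₁) (rep S₂) (rep S₃) (rep S₄) j₁ j₂ j₃ j₄ k (digit-sum j₁ j₂ j₃ j₄ j₁+j₂≡w j₃+j₄≡k-w))
          (ih (refine S₁ j₁<p) (refine S₂ j₂<p) (refine S₃ j₃<p) (refine S₄ j₄<p) large₁₂′ large₃₄′
             (k / p + pred (product ps) * ((j₁ + j₂ + j₃ + j₄) / p)))

  unitSubset : (A : Subset q) → UnitSubset q A → UnitClassSubset 1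
  unitSubset A A⊆units = record
    { rep = 0
    ; rep<n = z<s
    ; members = memberᵇ A
    ; members⊆class = λ x x<q x∈A →
        cong₂ _∧_ (coprime⇒isUnit (subst (λ y → Coprime y q) (toℕ-fromℕ< x<q) (A⊆units _ (memberᵇ⇒∈-fromℕ< A x<q x∈A))))
                  (≡⇒≡ᵇ≡true (n%1≡0 x))
    }

  fourfoldSum⇒InFourfoldSum : ∀ A z → FourfoldSum (memberᵇ A) (memberᵇ A) (memberᵇ A) (memberᵇ A) (toℕ z) → InFourfoldSum q A z
  fourfoldSum⇒InFourfoldSum A z (fourfoldSum {a₁} {a₂} {a₃} {a₄} (a₁<q , a₁∈A) (a₂<q , a₂∈A) (a₃<q , a₃∈A) (a₄<q , a₄∈A) sum≡z) =
    fromℕ< a₁<q , fromℕ< a₂<q , fromℕ< a₃<q , fromℕ< a₄<q ,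
    memberᵇ⇒∈-fromℕ< A a₁<q a₁∈A , memberᵇ⇒∈-fromℕ< A a₂<q a₂∈A ,
    memberᵇ⇒∈-fromℕ< A a₃<q a₃∈A , memberᵇ⇒∈-fromℕ< A a₄<q a₄∈A ,
    (begin
      (toℕ (fromℕ< a₁<q) + toℕ (fromℕ< a₂<q) + toℕ (fromℕ< a₃<q) + toℕ (fromℕ< a₄<q)) % q
        ≡⟨ cong (_% q) (cong₂ _+_ (cong₂ _+_ (cong₂ _+_ (toℕ-fromℕ< a₁<q) (toℕ-fromℕ< a₂<q))
                                             (toℕ-fromℕ< a₃<q)) (toℕ-fromℕ< a₄<q)) ⟩
      (a₁ + a₂ + a₃ + a₄) % q
        ≡⟨ sum≡z ⟩
      toℕ z % q
        ≡⟨ m<n⇒m%n≡m (toℕ<n z) ⟩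
      toℕ z
        ∎)
    where open ≡-Reasoning

  reachable : ¬ 2 ∣ q → ∀ ps n .{{_ : NonZero n}} → All Prime ps → n * product ps ≡ q → Reachable ps n
  reachable q-odd [] n [] n*1≡q = reachable-[] n n*1≡q
  reachable q-odd (p ∷ ps) n (p-prime ∷ ps-prime) n*pR≡q =
    Step.reachable-step p-prime (odd-prime>2 q-odd p-prime p∣q) ps-prime n*pR≡q
      (reachable q-odd ps (p * n) ps-prime pn*R≡q)
    where open Refinement p-prime n*pR≡q

corollary1p3 : (q : ℕ) .{{_ : NonZero q}} → (2 ∣ q → ⊥) → SquareFree q →
    (A : Subset q) → UnitSubset q A → φ q < 2 * ∣ A ∣ →
    (z : Fin q) → InFourfoldSum q A z
corollary1p3 q q-odd q-squarefree A A⊆units φ<2∣A∣ z =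
  fourfoldSum⇒InFourfoldSum A z
    (fourfoldSum-⊆ id id id id (cong (_% q) (*-identityʳ (toℕ z)))
      (reachable q-odd fs 1 fs-prime (trans (*-identityˡ (product fs)) (sym q≡∏fs)) S S S S large large (toℕ z)))
  where
  open UnitClasses q q-squarefree
  open FourfoldSums q q-squarefree
  open PrimeFactorisation (factorise q) renaming (factors to fs; factorsPrime to fs-prime; isFactorisation to q≡∏fs)
  S = unitSubset A A⊆units
  large : φ∏ fs < size S + size S
  large = begin-strict
    φ∏ fs                   ≤⟨ φ∏≤φ fs fs-prime (sym q≡∏fs) ⟩
    φ q                     <⟨ φ<2∣A∣ ⟩
    2 * ∣ A ∣               ≡⟨ cong (∣ A ∣ +_) (+-identityʳ ∣ A ∣) ⟩
    ∣ A ∣ + ∣ A ∣           ≡⟨ cong₂ _+_ (∣A∣≡count-memberᵇ A) (∣A∣≡count-memberᵇ A) ⟩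
    size S + size S         ∎
    where open ≤-Reasoning
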